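{- Let $G$ be a graph on $n$ vertices and let $G^{+}$ be the graph obtained from $G$ as follows: for each vertex $u\in V(G)$ add six new vertices $u_1,u_2,u_3,u_1',u_2',u_3'$; make $u_i$ and $u_j$ adjacent for all $i\ne j$ in $\{1,2,3\}$; make each $u_i$ adjacent to $u$ and to $u_i'$ for $i\in\{1,2,3\}$; and for every edge $uv\in E(G)$ add the edges $u_1'v$ and $v_1'u$. Then $\rho(G^{+})=2n+\rho^{\rm o}(G)$. In addition, $G$ has a unique maximum open packing if and only if $G^{+}$ has a unique maximum 2-packing.
   Context: An open packing in a graph is a set of vertices whose open neighborhoods are pairwise disjoint; $\rho^{\rm o}$ denotes the maximum cardinality of an open packing. A 2-packing is a set of vertices whose closed neighborhoods are pairwise disjoint; $\rho$ denotes the maximum cardinality of a 2-packing. -}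

module Defs where

open import Data.Nat using (ℕ; _≤_; _*_)
open import Data.Fin using (Fin; zero; suc; remQuot)
open import Data.Fin.Subset using (Subset; _∈_; ∣_∣)
open import Data.Product using (_×_; Σ; _,_; proj₁; proj₂)
open import Data.Sum using (_⊎_)
open import Data.Empty using (⊥)
open import Relation.Nullary using (¬_)
open import Relation.Binary.PropositionalEquality using (_≡_; _≢_)
open import Level using (0ℓ)

record Graph (n : ℕ) : Set₁ where
  field
    Adj   : Fin n → Fin n → Set
    sym   : ∀ {u v} → Adj u v → Adj v u
    irrefl : ∀ {u} → ¬ Adj u u

IsOpenPacking : ∀ {m} → (Fin m → Fin m → Set) → Subset m → Set
IsOpenPacking A S =
  ∀ x y → x ∈ S → y ∈ S → x ≢ y → ∀ w → ¬ (A x w × A y w)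

Is2Packing : ∀ {m} → (Fin m → Fin m → Set) → Subset m → Set
Is2Packing A S =
  ∀ x y → x ∈ S → y ∈ S → x ≢ y → ∀ w → ¬ ((w ≡ x ⊎ A x w) × (w ≡ y ⊎ A y w))

IsMaxCard : ∀ {m} → (Subset m → Set) → ℕ → Set
IsMaxCard {m} P k = Σ (Subset m) (λ S → P S × ∣ S ∣ ≡ k) × (∀ T → P T → ∣ T ∣ ≤ k)

HasUniqueMax : ∀ {m} → (Subset m → Set) → Set
HasUniqueMax {m} P =
  Σ (Subset m) λ S → P S × (∀ T → P T → ∣ T ∣ ≤ ∣ S ∣) × (∀ T → P T → ∣ T ∣ ≡ ∣ S ∣ → T ≡ S)

-- Vertex kinds of G⁺: for u, the original vertex u, u₁,u₂,u₃ and u₁',u₂',u₃'.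
data Kind : Set where
  orig c₁ c₂ c₃ p₁ p₂ p₃ : Kind

kindOf : Fin 7 → Kind
kindOf zero = orig
kindOf (suc zero) = c₁
kindOf (suc (suc zero)) = c₂
kindOf (suc (suc (suc zero))) = c₃
kindOf (suc (suc (suc (suc zero)))) = p₁
kindOf (suc (suc (suc (suc (suc zero))))) = p₂
kindOf (suc (suc (suc (suc (suc (suc zero)))))) = p₃

PlusAdjK : ∀ {n} → (Fin n → Fin n → Set) → Kind → Fin n → Kind → Fin n → Set
PlusAdjK A orig u orig v = A u v
PlusAdjK A orig u c₁ v = u ≡ v
PlusAdjK A orig u c₂ v = u ≡ v
PlusAdjK A orig u c₃ v = u ≡ v
PlusAdjK A c₁ u orig v = u ≡ v
PlusAdjK A c₂ u orig v = u ≡ v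
PlusAdjK A c₃ u orig v = u ≡ v
PlusAdjK A c₁ u c₂ v = u ≡ v
PlusAdjK A c₁ u c₃ v = u ≡ v
PlusAdjK A c₂ u c₁ v = u ≡ v
PlusAdjK A c₂ u c₃ v = u ≡ v
PlusAdjK A c₃ u c₁ v = u ≡ v
PlusAdjK A c₃ u c₂ v = u ≡ v
PlusAdjK A c₁ u p₁ v = u ≡ v
PlusAdjK A c₂ u p₂ v = u ≡ v
PlusAdjK A c₃ u p₃ v = u ≡ v
PlusAdjK A p₁ u c₁ v = u ≡ v
PlusAdjK A p₂ u c₂ v = u ≡ v
PlusAdjK A p₃ u c₃ v = u ≡ v
PlusAdjK A p₁ u orig v = A u v
PlusAdjK A orig u p₁ v = A v u              -- v₁' u for uv ∈ E(G) (i.e. u adjacent to v₁')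
PlusAdjK A _ _ _ _ = ⊥

decode : ∀ {n} → Fin (7 * n) → Kind × Fin n
decode {n} x = kindOf (proj₁ (remQuot {7} n x)) , proj₂ (remQuot {7} n x)

PlusAdj : ∀ {n} → Graph n → Fin (7 * n) → Fin (7 * n) → Set
PlusAdj {n} G x y =
  PlusAdjK (Graph.Adj G) (proj₁ (decode {n} x)) (proj₂ (decode {n} x)) (proj₁ (decode {n} y)) (proj₂ (decode {n} y))

module Submission where

-- Label the vertices of G⁺ by pairs (i , u) with i : Fin 7 and u a
-- vertex of G: i = 0 is u itself, i = 1,2,3 the triangle u₁,u₂,u₃ and i = 4,5,6
-- the pendant vertices u₁',u₂',u₃'.  A subset of G⁺ is then a vector of seven
-- "blocks" (subsets of V(G)), one per label.
--
--  * Lifting: for an open packing S of G, the set {u₁' : u ∈ S} ∪ {u₂',u₃' : u}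
--    is a 2-packing of G⁺ of size 2n + |S|.
--  * Shadow: for a 2-packing T of G⁺, the owners of the u₁' in T form an open
--    packing of G; the labels u,u₁,u₂,u₃,u₂' all lie in N[u₂] and u,u₁,u₂,u₃,u₃'
--    in N[u₃], so T uses at most 2 of them per u, whence |T| ≤ 2n + |shadow|,
--    with equality only if T is the lift of its shadow.

open import Defs
open import Data.Nat using (ℕ; suc; _+_; _*_; _≤_)
open import Data.Nat.Properties
open import Data.Nat.Tactic.RingSolver using (solve-∀)
open import Data.Fin using (Fin; combine; remQuot)
open import Data.Fin.Patterns using (0F; 1F; 2F; 3F; 4F; 5F; 6F)
open import Data.Fin.Properties using (remQuot-combine; combine-remQuot)
open import Data.Fin.Subset using (Subset; _∈_; ∣_∣; _∪_; ⋃; inside; outside)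
  renaming (⊥ to ∅; ⊤ to full)
open import Data.Fin.Subset.Properties using (∉⊥; ∣p∣≤n; ∣⊥∣≡0; ∣⊤∣≡n; ∣p∣≡n⇒p≡⊤; x∈p∪q⁻)
open import Data.Vec using (Vec; []; _∷_; lookup; concat; _++_; group; here; there)
import Data.Vec as Vec
open import Data.Vec.Properties using (lookup-concat; []=⇒lookup; lookup⇒[]=; ++-injectiveˡ; ++-injectiveʳ)
open import Data.List using (List; []; _∷_; map)
open import Data.Nat.ListAction using (sum)
open import Data.List.Relation.Unary.All using (All; []; _∷_)
open import Data.List.Relation.Unary.AllPairs using (AllPairs; []; _∷_)
open import Data.Product using (_×_; _,_; proj₁; proj₂)
open import Data.Sum using (_⊎_; inj₁; inj₂)
open import Data.Empty using (⊥; ⊥-elim)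
open import Function.Bundles using (_⇔_; mk⇔)
open import Relation.Binary.PropositionalEquality

record Correspondence {m m′ : ℕ} (P : Subset m → Set) (Q : Subset m′ → Set) (c : ℕ) : Set where
  field
    lift           : Subset m → Subset m′
    lift-sound     : ∀ S → P S → Q (lift S)
    lift-card      : ∀ S → ∣ lift S ∣ ≡ c + ∣ S ∣
    lift-injective : ∀ S S′ → lift S ≡ lift S′ → S ≡ S′
    shadow         : Subset m′ → Subset m
    shadow-sound   : ∀ T → Q T → P (shadow T)
    shadow-bound   : ∀ T → Q T → ∣ T ∣ ≤ c + ∣ shadow T ∣
    shadow-tight   : ∀ T → Q T → ∣ T ∣ ≡ c + ∣ shadow T ∣ → T ≡ lift (shadow T)

module _ {m m′ : ℕ} {P : Subset m → Set} {Q : Subset m′ → Set} {c : ℕ}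
         (corr : Correspondence P Q c) where
  open Correspondence corr

  maxCard-shift : ∀ k → IsMaxCard P k → IsMaxCard Q (c + k)
  maxCard-shift k ((S , pS , ∣S∣≡k) , maxP) =
    (lift S , lift-sound S pS , trans (lift-card S) (cong (c +_) ∣S∣≡k)) ,
    λ T qT → ≤-trans (shadow-bound T qT) (+-monoʳ-≤ c (maxP (shadow T) (shadow-sound T qT)))

  uniqueMax-lift : HasUniqueMax P → HasUniqueMax Q
  uniqueMax-lift (S₀ , pS₀ , maxP , uniqP) = lift S₀ , lift-sound S₀ pS₀ , bound , unique
    where
    bound : ∀ T → Q T → ∣ T ∣ ≤ ∣ lift S₀ ∣
    bound T qT = begin
      ∣ T ∣                 ≤⟨ shadow-bound T qT ⟩
      c + ∣ shadow T ∣      ≤⟨ +-monoʳ-≤ c (maxP (shadow T) (shadow-sound T qT)) ⟩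
      c + ∣ S₀ ∣            ≡⟨ lift-card S₀ ⟨
      ∣ lift S₀ ∣           ∎
      where open ≤-Reasoning
    unique : ∀ T → Q T → ∣ T ∣ ≡ ∣ lift S₀ ∣ → T ≡ lift S₀
    unique T qT ∣T∣≡ = trans (shadow-tight T qT ∣T∣≡c+shadow) (cong lift shadow≡S₀)
      where
      ∣T∣≡c+S₀ : ∣ T ∣ ≡ c + ∣ S₀ ∣
      ∣T∣≡c+S₀ = trans ∣T∣≡ (lift-card S₀)
      ∣shadow∣≡ : ∣ shadow T ∣ ≡ ∣ S₀ ∣
      ∣shadow∣≡ = ≤-antisym (maxP (shadow T) (shadow-sound T qT))
        (+-cancelˡ-≤ c _ _ (subst (_≤ c + ∣ shadow T ∣) ∣T∣≡c+S₀ (shadow-bound T qT)))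
      shadow≡S₀ : shadow T ≡ S₀
      shadow≡S₀ = uniqP (shadow T) (shadow-sound T qT) ∣shadow∣≡
      ∣T∣≡c+shadow : ∣ T ∣ ≡ c + ∣ shadow T ∣
      ∣T∣≡c+shadow = trans ∣T∣≡c+S₀ (cong (c +_) (sym ∣shadow∣≡))

  uniqueMax-shadow : HasUniqueMax Q → HasUniqueMax P
  uniqueMax-shadow (T₀ , qT₀ , maxQ , uniqQ) = S₀ , shadow-sound T₀ qT₀ , bound , unique
    where
    S₀ : Subset m
    S₀ = shadow T₀
    lift-bound : ∀ S → P S → c + ∣ S ∣ ≤ c + ∣ S₀ ∣
    lift-bound S pS = begin
      c + ∣ S ∣     ≡⟨ lift-card S ⟨
      ∣ lift S ∣    ≤⟨ maxQ (lift S) (lift-sound S pS) ⟩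
      ∣ T₀ ∣        ≤⟨ shadow-bound T₀ qT₀ ⟩
      c + ∣ S₀ ∣    ∎
      where open ≤-Reasoning
    bound : ∀ S → P S → ∣ S ∣ ≤ ∣ S₀ ∣
    bound S pS = +-cancelˡ-≤ c _ _ (lift-bound S pS)
    lift≡T₀ : ∀ S → P S → ∣ S ∣ ≡ ∣ S₀ ∣ → lift S ≡ T₀
    lift≡T₀ S pS ∣S∣≡ = uniqQ (lift S) (lift-sound S pS) (≤-antisym (maxQ (lift S) (lift-sound S pS))
      (≤-trans (shadow-bound T₀ qT₀) (≤-reflexive (trans (cong (c +_) (sym ∣S∣≡)) (sym (lift-card S))))))
    unique : ∀ S → P S → ∣ S ∣ ≡ ∣ S₀ ∣ → S ≡ S₀
    unique S pS ∣S∣≡ = lift-injective S S₀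
      (trans (lift≡T₀ S pS ∣S∣≡) (sym (lift≡T₀ S₀ (shadow-sound T₀ qT₀) refl)))

  uniqueMax-shift : HasUniqueMax P ⇔ HasUniqueMax Q
  uniqueMax-shift = mk⇔ uniqueMax-lift uniqueMax-shadow

Disjoint : ∀ {n} → Subset n → Subset n → Set
Disjoint p q = ∀ {x} → x ∈ p → x ∈ q → ⊥

∣p++q∣ : ∀ {m n} (p : Subset m) (q : Subset n) → ∣ p ++ q ∣ ≡ ∣ p ∣ + ∣ q ∣
∣p++q∣ []            q = refl
∣p++q∣ (inside  ∷ p) q = cong suc (∣p++q∣ p q)
∣p++q∣ (outside ∷ p) q = ∣p++q∣ p q

∣concat∣ : ∀ {k n} (B : Vec (Subset n) k) → ∣ concat B ∣ ≡ Vec.sum (Vec.map ∣_∣ B)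
∣concat∣ []      = refl
∣concat∣ (p ∷ B) = trans (∣p++q∣ p (concat B)) (cong (∣ p ∣ +_) (∣concat∣ B))

disjoint-tail : ∀ {n} {s t} {p q : Subset n} → Disjoint (s ∷ p) (t ∷ q) → Disjoint p q
disjoint-tail d x∈p x∈q = d (there x∈p) (there x∈q)

∣p∪q∣-disjoint : ∀ {n} (p q : Subset n) → Disjoint p q → ∣ p ∪ q ∣ ≡ ∣ p ∣ + ∣ q ∣
∣p∪q∣-disjoint []            []            _ = refl
∣p∪q∣-disjoint (inside  ∷ p) (inside  ∷ q) d = ⊥-elim (d here here)
∣p∪q∣-disjoint (inside  ∷ p) (outside ∷ q) d = cong suc (∣p∪q∣-disjoint p q (disjoint-tail d))
∣p∪q∣-disjoint (outside ∷ p) (inside  ∷ q) d =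
  trans (cong suc (∣p∪q∣-disjoint p q (disjoint-tail d))) (sym (+-suc ∣ p ∣ ∣ q ∣))
∣p∪q∣-disjoint (outside ∷ p) (outside ∷ q) d = ∣p∪q∣-disjoint p q (disjoint-tail d)

disjoint-⋃ : ∀ {n} {p : Subset n} (qs : List (Subset n)) → All (Disjoint p) qs → Disjoint p (⋃ qs)
disjoint-⋃ []       []       _   x∈∅   = ∉⊥ x∈∅
disjoint-⋃ (q ∷ qs) (d ∷ ds) x∈p x∈q∪ with x∈p∪q⁻ q (⋃ qs) x∈q∪
... | inj₁ x∈q  = d x∈p x∈q
... | inj₂ x∈qs = disjoint-⋃ qs ds x∈p x∈qs

pairwiseDisjoint-sum≤ : ∀ {n} (ps : List (Subset n)) → AllPairs Disjoint ps → sum (map ∣_∣ ps) ≤ n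
pairwiseDisjoint-sum≤ {n} ps disjoint = subst (_≤ n) (∣⋃∣ ps disjoint) (∣p∣≤n (⋃ ps))
  where
  ∣⋃∣ : ∀ ps → AllPairs Disjoint ps → ∣ ⋃ ps ∣ ≡ sum (map ∣_∣ ps)
  ∣⋃∣ []       []         = ∣⊥∣≡0 n
  ∣⋃∣ (p ∷ ps) (ds ∷ dss) =
    trans (∣p∪q∣-disjoint p (⋃ ps) (disjoint-⋃ ps ds)) (cong (∣ p ∣ +_) (∣⋃∣ ps dss))

∣p∣≡0⇒p≡∅ : ∀ {n} (p : Subset n) → ∣ p ∣ ≡ 0 → p ≡ ∅
∣p∣≡0⇒p≡∅ []            _  = refl
∣p∣≡0⇒p≡∅ (outside ∷ p) eq = cong (outside ∷_) (∣p∣≡0⇒p≡∅ p eq)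

shared-room : ∀ {n} c x y → c + x ≤ n → c + y ≤ n →
  c + (x + y) ≤ 2 * n × (c + (x + y) ≡ 2 * n → c ≡ 0 × x ≡ n × y ≡ n)
shared-room {n} c x y c+x≤n c+y≤n = bound , tight
  where
  2n≡n+n : 2 * n ≡ n + n
  2n≡n+n = cong (n +_) (+-identityʳ n)
  rearrange : ∀ c x y → (c + x) + (c + y) ≡ c + (c + (x + y))
  rearrange = solve-∀
  twice : c + (c + (x + y)) ≤ 2 * n
  twice = subst₂ _≤_ (rearrange c x y) (sym 2n≡n+n) (+-mono-≤ c+x≤n c+y≤n)
  bound : c + (x + y) ≤ 2 * n
  bound = ≤-trans (m≤n+m (c + (x + y)) c) twice
  tight : c + (x + y) ≡ 2 * n → c ≡ 0 × x ≡ n × y ≡ n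
  tight eq = c≡0 , ≤-antisym x≤n n≤x , ≤-antisym y≤n n≤y
    where
    c≡0 : c ≡ 0
    c≡0 = n≤0⇒n≡0 (+-cancelʳ-≤ (2 * n) c 0 (subst (λ t → c + t ≤ 2 * n) eq twice))
    x≤n : x ≤ n
    x≤n = m+n≤o⇒n≤o c c+x≤n
    y≤n : y ≤ n
    y≤n = m+n≤o⇒n≤o c c+y≤n
    x+y≡n+n : x + y ≡ n + n
    x+y≡n+n = trans (sym (cong (_+ (x + y)) c≡0)) (trans eq 2n≡n+n)
    -- n + n = x + y: raising one summand to n bounds the other from below by n
    n≤x : n ≤ x
    n≤x = +-cancelʳ-≤ n n x (subst (_≤ x + n) x+y≡n+n (+-monoʳ-≤ x y≤n))
    n≤y : n ≤ y
    n≤y = +-cancelʳ-≤ n n y (subst (_≤ y + n) (trans (+-comm y x) x+y≡n+n) (+-monoʳ-≤ y x≤n))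

module Gadget {n : ℕ} (G : Graph n) where
  open Graph G using (Adj)

  Label : Set
  Label = Fin 7 × Fin n

  label : Fin (7 * n) → Label
  label x = remQuot {7} n x

  vertex : Label → Fin (7 * n)
  vertex (i , u) = combine i u

  label-vertex : ∀ a → label (vertex a) ≡ a
  label-vertex (i , u) = remQuot-combine i u

  vertex-label : ∀ x → vertex (label x) ≡ x
  vertex-label x = combine-remQuot {7} n x

  -- The edge relation of G⁺ on labels; PlusAdj G x y unfolds to Edge (label x) (label y).
  Edge : Label → Label → Set
  Edge (i , u) (k , z) = PlusAdjK Adj (kindOf i) u (kindOf k) z

  Closed : Label → Label → Set
  Closed a b = b ≡ a ⊎ Edge a b

  Blocks : Set
  Blocks = Vec (Subset n) 7

  _∈ᴮ_ : Label → Blocks → Set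
  (i , u) ∈ᴮ B = u ∈ lookup B i

  ∈concat⁺ : ∀ B a → a ∈ᴮ B → vertex a ∈ concat B
  ∈concat⁺ B (i , u) u∈ = lookup⇒[]= (combine i u) (concat B) (trans (lookup-concat B i u) ([]=⇒lookup u∈))

  ∈concat⁻ : ∀ B x → x ∈ concat B → label x ∈ᴮ B
  ∈concat⁻ B x x∈ = lookup⇒[]= u (lookup B i) (trans (sym (lookup-concat B i u)) ([]=⇒lookup x′∈))
    where
    i : Fin 7
    i = proj₁ (label x)
    u : Fin n
    u = proj₂ (label x)
    x′∈ : vertex (label x) ∈ concat B
    x′∈ = subst (_∈ concat B) (sym (vertex-label x)) x∈

  Is2Packingᴸ : Blocks → Set
  Is2Packingᴸ B = ∀ a b c → a ∈ᴮ B → b ∈ᴮ B → a ≢ b → Closed a c → Closed b c → ⊥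

  labelled⇒packing : ∀ B → Is2Packingᴸ B → Is2Packing (PlusAdj G) (concat B)
  labelled⇒packing B L x y x∈ y∈ x≢y w (wx , wy) =
    L (label x) (label y) (label w) (∈concat⁻ B x x∈) (∈concat⁻ B y y∈) labels-differ (closed wx) (closed wy)
    where
    labels-differ : label x ≢ label y
    labels-differ e = x≢y (trans (sym (vertex-label x)) (trans (cong vertex e) (vertex-label y)))
    closed : ∀ {v} → w ≡ v ⊎ PlusAdj G v w → Closed (label v) (label w)
    closed (inj₁ w≡v) = inj₁ (cong label w≡v)
    closed (inj₂ vw)  = inj₂ vw

  packing⇒labelled : ∀ B → Is2Packing (PlusAdj G) (concat B) → Is2Packingᴸ B
  packing⇒labelled B P a b c a∈ b∈ a≢b ca cb =
    P (vertex a) (vertex b) (∈concat⁺ B a a∈) (∈concat⁺ B b b∈) vertices-differ (vertex c) (closed ca , closed cb)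
    where
    vertices-differ : vertex a ≢ vertex b
    vertices-differ e = a≢b (trans (sym (label-vertex a)) (trans (cong label e) (label-vertex b)))
    closed : ∀ {d} → Closed d c → vertex c ≡ vertex d ⊎ PlusAdj G (vertex d) (vertex c)
    closed     (inj₁ c≡d) = inj₁ (cong vertex c≡d)
    closed {d} (inj₂ dc)  = inj₂ (subst₂ Edge (sym (label-vertex d)) (sym (label-vertex c)) dc)

  liftBlocks : Subset n → Blocks
  liftBlocks S = ∅ ∷ ∅ ∷ ∅ ∷ ∅ ∷ S ∷ full ∷ full ∷ []

  liftSet : Subset n → Subset (7 * n)
  liftSet S = concat (liftBlocks S)

  -- The pendant kind whose closed neighbourhood contains a vertex of kind k ≠ 0:
  -- u_i and u_i' lie only in N[u_i'] among pendant vertices.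
  partner : Fin 7 → Fin 7
  partner 1F = 4F
  partner 2F = 5F
  partner 3F = 6F
  partner k  = k

  -- Closed neighbourhoods of the vertices of a lift: N[u₁'] = {u₁', u₁} ∪ N_G(u)
  -- and N[u_i'] = {u_i', u_i} for i = 2, 3.  So a label (k , z) lies in N[a] only
  -- if k = 0 and a = (4 , u) with uz ∈ E(G), or k ≠ 0 and a = (partner k , z).
  lift-witness : ∀ {S} i u k z → (i , u) ∈ᴮ liftBlocks S → Closed (i , u) (k , z) →
    (k ≡ 0F × i ≡ 4F × Adj u z) ⊎ (k ≢ 0F × (i , u) ≡ (partner k , z))
  lift-witness 0F u k  z u∈ _               = ⊥-elim (∉⊥ u∈)
  lift-witness 1F u k  z u∈ _               = ⊥-elim (∉⊥ u∈)
  lift-witness 2F u k  z u∈ _               = ⊥-elim (∉⊥ u∈)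
  lift-witness 3F u k  z u∈ _               = ⊥-elim (∉⊥ u∈)
  lift-witness 4F u k  z _  (inj₁ refl)     = inj₂ ((λ ()) , refl)
  lift-witness 4F u 0F z _  (inj₂ uz)       = inj₁ (refl , refl , uz)
  lift-witness 4F u 1F z _  (inj₂ refl)     = inj₂ ((λ ()) , refl)
  lift-witness 4F u 2F z _  (inj₂ ())
  lift-witness 4F u 3F z _  (inj₂ ())
  lift-witness 4F u 4F z _  (inj₂ ())
  lift-witness 4F u 5F z _  (inj₂ ())
  lift-witness 4F u 6F z _  (inj₂ ())
  lift-witness 5F u k  z _  (inj₁ refl)     = inj₂ ((λ ()) , refl)
  lift-witness 5F u 0F z _  (inj₂ ())
  lift-witness 5F u 1F z _  (inj₂ ())
  lift-witness 5F u 2F z _  (inj₂ refl)     = inj₂ ((λ ()) , refl)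
  lift-witness 5F u 3F z _  (inj₂ ())
  lift-witness 5F u 4F z _  (inj₂ ())
  lift-witness 5F u 5F z _  (inj₂ ())
  lift-witness 5F u 6F z _  (inj₂ ())
  lift-witness 6F u k  z _  (inj₁ refl)     = inj₂ ((λ ()) , refl)
  lift-witness 6F u 0F z _  (inj₂ ())
  lift-witness 6F u 1F z _  (inj₂ ())
  lift-witness 6F u 2F z _  (inj₂ ())
  lift-witness 6F u 3F z _  (inj₂ refl)     = inj₂ ((λ ()) , refl)
  lift-witness 6F u 4F z _  (inj₂ ())
  lift-witness 6F u 5F z _  (inj₂ ())
  lift-witness 6F u 6F z _  (inj₂ ())

  -- The lift of an open packing of G is a 2-packing of G⁺: two lifted vertices
  -- can only share a label of kind 0, and then S would not be an open packing.
  liftSet-packing : ∀ S → IsOpenPacking Adj S → Is2Packing (PlusAdj G) (liftSet S)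
  liftSet-packing S open-S = labelled⇒packing (liftBlocks S) no-shared-label
    where
    no-shared-label : Is2Packingᴸ (liftBlocks S)
    no-shared-label (i , u) (j , v) (k , z) a∈ b∈ a≢b ca cb
      with lift-witness i u k z a∈ ca | lift-witness j v k z b∈ cb
    ... | inj₁ (refl , refl , uz) | inj₁ (_ , refl , vz) =
      open-S u v a∈ b∈ (λ u≡v → a≢b (cong (4F ,_) u≡v)) z (uz , vz)
    ... | inj₁ (refl , _)    | inj₂ (k≢0 , _)   = k≢0 refl
    ... | inj₂ (k≢0 , _)     | inj₁ (refl , _)  = k≢0 refl
    ... | inj₂ (_ , a≡)      | inj₂ (_ , b≡)    = a≢b (trans a≡ (sym b≡))

  liftSet-card : ∀ S → ∣ liftSet S ∣ ≡ 2 * n + ∣ S ∣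
  liftSet-card S = begin
    ∣ liftSet S ∣                                    ≡⟨ ∣concat∣ (liftBlocks S) ⟩
    e + (e + (e + (e + (∣ S ∣ + (f + (f + 0))))))    ≡⟨ cong₂ (λ a b → a + (a + (a + (a + (∣ S ∣ + (b + (b + 0)))))))
                                                         (∣⊥∣≡0 n) (∣⊤∣≡n n) ⟩
    ∣ S ∣ + 2 * n                                    ≡⟨ +-comm ∣ S ∣ (2 * n) ⟩
    2 * n + ∣ S ∣                                    ∎
    where
    open ≡-Reasoning
    e f : ℕ
    e = ∣ ∅ {n} ∣
    f = ∣ full {n} ∣

  liftSet-injective : ∀ S S′ → liftSet S ≡ liftSet S′ → S ≡ S′
  liftSet-injective S S′ eq = ++-injectiveˡ S S′ (drop (drop (drop (drop eq))))
    where
    drop : ∀ {k} {xs ys : Subset k} → ∅ {n} ++ xs ≡ ∅ {n} ++ ys → xs ≡ ys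
    drop = ++-injectiveʳ ∅ ∅

  conflict : ∀ B → Is2Packingᴸ B → ∀ {i j} k → i ≢ j →
    (∀ u → Closed (i , u) (k , u)) → (∀ u → Closed (j , u) (k , u)) → Disjoint (lookup B i) (lookup B j)
  conflict B L {i} {j} k i≢j ci cj {u} u∈i u∈j =
    L (i , u) (j , u) (k , u) u∈i u∈j (λ e → i≢j (cong proj₁ e)) (ci u) (cj u)

  sharedWitness-disjoint : ∀ B → Is2Packingᴸ B → ∀ k {is : List (Fin 7)} → AllPairs _≢_ is →
    All (λ i → ∀ u → Closed (i , u) (k , u)) is → AllPairs Disjoint (map (lookup B) is)
  sharedWitness-disjoint B L k []                []         = []
  sharedWitness-disjoint B L k {i ∷ _} (i≢js ∷ distinct) (ci ∷ cjs) =
    with-head i≢js cjs ∷ sharedWitness-disjoint B L k distinct cjs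
    where
    with-head : ∀ {js} → All (i ≢_) js → All (λ j → ∀ u → Closed (j , u) (k , u)) js →
      All (Disjoint (lookup B i)) (map (lookup B) js)
    with-head []           []         = []
    with-head (i≢j ∷ i≢js) (cj ∷ cjs) = conflict B L k i≢j ci cj ∷ with-head i≢js cjs

  -- The owners of the u₁' in a 2-packing form an open packing of G: a common
  -- G-neighbour z of u and v would be a common neighbour of u₁' and v₁'.
  block₄-open : ∀ B → Is2Packingᴸ B → IsOpenPacking Adj (lookup B 4F)
  block₄-open B L u v u∈ v∈ u≢v z (uz , vz) =
    L (4F , u) (4F , v) (0F , z) u∈ v∈ (λ e → u≢v (cong proj₂ e)) (inj₂ uz) (inj₂ vz)

  coreSize : Blocks → ℕ
  coreSize B = ∣ lookup B 0F ∣ + (∣ lookup B 1F ∣ + (∣ lookup B 2F ∣ + ∣ lookup B 3F ∣))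

  regroup : ∀ a₀ a₁ a₂ a₃ a → a₀ + (a₁ + (a₂ + (a₃ + (a + 0)))) ≡ (a₀ + (a₁ + (a₂ + a₃))) + a
  regroup = solve-∀

  -- u, u₁, u₂, u₃ and u₂' all lie in N[u₂], so a 2-packing uses at most one of them per u.
  room₂ : ∀ B → Is2Packingᴸ B → coreSize B + ∣ lookup B 5F ∣ ≤ n
  room₂ B@(b₀ ∷ b₁ ∷ b₂ ∷ b₃ ∷ _ ∷ b₅ ∷ _ ∷ []) L =
    subst (_≤ n) (regroup (∣ b₀ ∣) (∣ b₁ ∣) (∣ b₂ ∣) (∣ b₃ ∣) (∣ b₅ ∣)) (pairwiseDisjoint-sum≤ _
      (sharedWitness-disjoint B L 2F distinct
        ((λ _ → inj₂ refl) ∷ (λ _ → inj₂ refl) ∷ (λ _ → inj₁ refl) ∷ (λ _ → inj₂ refl) ∷ (λ _ → inj₂ refl) ∷ [])))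
    where
    distinct : AllPairs _≢_ (0F ∷ 1F ∷ 2F ∷ 3F ∷ 5F ∷ [])
    distinct = ((λ ()) ∷ (λ ()) ∷ (λ ()) ∷ (λ ()) ∷ []) ∷ ((λ ()) ∷ (λ ()) ∷ (λ ()) ∷ []) ∷
               ((λ ()) ∷ (λ ()) ∷ []) ∷ ((λ ()) ∷ []) ∷ [] ∷ []

  -- Likewise u, u₁, u₂, u₃ and u₃' all lie in N[u₃].
  room₃ : ∀ B → Is2Packingᴸ B → coreSize B + ∣ lookup B 6F ∣ ≤ n
  room₃ B@(b₀ ∷ b₁ ∷ b₂ ∷ b₃ ∷ _ ∷ _ ∷ b₆ ∷ []) L =
    subst (_≤ n) (regroup (∣ b₀ ∣) (∣ b₁ ∣) (∣ b₂ ∣) (∣ b₃ ∣) (∣ b₆ ∣)) (pairwiseDisjoint-sum≤ _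
      (sharedWitness-disjoint B L 3F distinct
        ((λ _ → inj₂ refl) ∷ (λ _ → inj₂ refl) ∷ (λ _ → inj₂ refl) ∷ (λ _ → inj₁ refl) ∷ (λ _ → inj₂ refl) ∷ [])))
    where
    distinct : AllPairs _≢_ (0F ∷ 1F ∷ 2F ∷ 3F ∷ 6F ∷ [])
    distinct = ((λ ()) ∷ (λ ()) ∷ (λ ()) ∷ (λ ()) ∷ []) ∷ ((λ ()) ∷ (λ ()) ∷ (λ ()) ∷ []) ∷
               ((λ ()) ∷ (λ ()) ∷ []) ∷ ((λ ()) ∷ []) ∷ [] ∷ []

  full-gadgets⇒lift : ∀ B → coreSize B ≡ 0 → ∣ lookup B 5F ∣ ≡ n → ∣ lookup B 6F ∣ ≡ n →
    B ≡ liftBlocks (lookup B 4F)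
  full-gadgets⇒lift (b₀ ∷ b₁ ∷ b₂ ∷ b₃ ∷ b₄ ∷ b₅ ∷ b₆ ∷ []) core≡0 ∣b₅∣≡n ∣b₆∣≡n =
    cong₂ _∷_ (empty b₀ e₀) (cong₂ _∷_ (empty b₁ e₁) (cong₂ _∷_ (empty b₂ e₂) (cong₂ _∷_ (empty b₃ e₃)
      (cong (b₄ ∷_) (cong₂ _∷_ (∣p∣≡n⇒p≡⊤ ∣b₅∣≡n) (cong (_∷ []) (∣p∣≡n⇒p≡⊤ ∣b₆∣≡n)))))))
    where
    empty : ∀ p → ∣ p ∣ ≡ 0 → p ≡ ∅
    empty = ∣p∣≡0⇒p≡∅
    e₀ : ∣ b₀ ∣ ≡ 0
    e₀ = m+n≡0⇒m≡0 ∣ b₀ ∣ core≡0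
    e₁ : ∣ b₁ ∣ ≡ 0
    e₁ = m+n≡0⇒m≡0 ∣ b₁ ∣ (m+n≡0⇒n≡0 ∣ b₀ ∣ core≡0)
    e₂ : ∣ b₂ ∣ ≡ 0
    e₂ = m+n≡0⇒m≡0 ∣ b₂ ∣ (m+n≡0⇒n≡0 ∣ b₁ ∣ (m+n≡0⇒n≡0 ∣ b₀ ∣ core≡0))
    e₃ : ∣ b₃ ∣ ≡ 0
    e₃ = m+n≡0⇒n≡0 ∣ b₂ ∣ (m+n≡0⇒n≡0 ∣ b₁ ∣ (m+n≡0⇒n≡0 ∣ b₀ ∣ core≡0))

  packing-bound : ∀ B → Is2Packingᴸ B →
    ∣ concat B ∣ ≤ 2 * n + ∣ lookup B 4F ∣ × (∣ concat B ∣ ≡ 2 * n + ∣ lookup B 4F ∣ → B ≡ liftBlocks (lookup B 4F))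
  packing-bound B@(b₀ ∷ b₁ ∷ b₂ ∷ b₃ ∷ b₄ ∷ b₅ ∷ b₆ ∷ []) L = bound , tight
    where
    regroup₇ : ∀ a₀ a₁ a₂ a₃ a₄ a₅ a₆ →
      a₀ + (a₁ + (a₂ + (a₃ + (a₄ + (a₅ + (a₆ + 0)))))) ≡ (a₀ + (a₁ + (a₂ + a₃))) + (a₅ + a₆) + a₄
    regroup₇ = solve-∀
    ∣T∣≡ : ∣ concat B ∣ ≡ coreSize B + (∣ b₅ ∣ + ∣ b₆ ∣) + ∣ b₄ ∣
    ∣T∣≡ = trans (∣concat∣ B) (regroup₇ (∣ b₀ ∣) (∣ b₁ ∣) (∣ b₂ ∣) (∣ b₃ ∣) (∣ b₄ ∣) (∣ b₅ ∣) (∣ b₆ ∣))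
    gadgets : coreSize B + (∣ b₅ ∣ + ∣ b₆ ∣) ≤ 2 * n
      × (coreSize B + (∣ b₅ ∣ + ∣ b₆ ∣) ≡ 2 * n → coreSize B ≡ 0 × ∣ b₅ ∣ ≡ n × ∣ b₆ ∣ ≡ n)
    gadgets = shared-room (coreSize B) (∣ b₅ ∣) (∣ b₆ ∣) (room₂ B L) (room₃ B L)
    bound : ∣ concat B ∣ ≤ 2 * n + ∣ b₄ ∣
    bound = subst (_≤ 2 * n + ∣ b₄ ∣) (sym ∣T∣≡) (+-monoˡ-≤ ∣ b₄ ∣ (proj₁ gadgets))
    tight : ∣ concat B ∣ ≡ 2 * n + ∣ b₄ ∣ → B ≡ liftBlocks b₄
    tight eq with proj₂ gadgets (+-cancelʳ-≡ ∣ b₄ ∣ _ _ (trans (sym ∣T∣≡) eq))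
    ... | core≡0 , ∣b₅∣≡n , ∣b₆∣≡n = full-gadgets⇒lift B core≡0 ∣b₅∣≡n ∣b₆∣≡n

  blocks : Subset (7 * n) → Blocks
  blocks T = proj₁ (group 7 n T)

  blocks-concat : ∀ T → T ≡ concat (blocks T)
  blocks-concat T = proj₂ (group 7 n T)

  blocks-packing : ∀ T → Is2Packing (PlusAdj G) T → Is2Packingᴸ (blocks T)
  blocks-packing T P = packing⇒labelled (blocks T) (subst (Is2Packing (PlusAdj G)) (blocks-concat T) P)

  shadow : Subset (7 * n) → Subset n
  shadow T = lookup (blocks T) 4F

  correspondence : Correspondence (IsOpenPacking Adj) (Is2Packing (PlusAdj G)) (2 * n)
  correspondence = record
    { lift           = liftSet
    ; lift-sound     = liftSet-packing
    ; lift-card      = liftSet-card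
    ; lift-injective = liftSet-injective
    ; shadow         = shadow
    ; shadow-sound   = λ T P → block₄-open (blocks T) (blocks-packing T P)
    ; shadow-bound   = λ T P → subst (λ T′ → ∣ T′ ∣ ≤ 2 * n + ∣ shadow T ∣) (sym (blocks-concat T))
                                 (proj₁ (packing-bound (blocks T) (blocks-packing T P)))
    ; shadow-tight   = λ T P eq → trans (blocks-concat T) (cong concat
                                 (proj₂ (packing-bound (blocks T) (blocks-packing T P))
                                   (subst (λ T′ → ∣ T′ ∣ ≡ 2 * n + ∣ shadow T ∣) (blocks-concat T) eq)))
    }

mainTheorem7 : ∀ (n : ℕ) (G : Graph n) →
    (∀ k → IsMaxCard (IsOpenPacking (Graph.Adj G)) k → IsMaxCard (Is2Packing (PlusAdj G)) (2 * n + k))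
    × (HasUniqueMax (IsOpenPacking (Graph.Adj G)) ⇔ HasUniqueMax (Is2Packing (PlusAdj G)))
mainTheorem7 n G = maxCard-shift correspondence , uniqueMax-shift correspondence
  where open Gadget G using (correspondence)
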